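{- In the edge-distinguishing game (EDGe) played on the cycle $C_6$ (with $\lambda(C_6)$ colors), Player 1 has a winning strategy.
   Context: $C_n$ is the cycle on $n$ vertices. For a positive integer $k$ let $[k]=\{1,\dots,k\}$. A $k$-coloring $c:V(G)\to[k]$ induces $c'(\{u,v\})=\{c(u),c(v)\}$ (a multiset); $c$ is edge-distinguishing if $c'$ is injective, and $\lambda(G)$ is the least $k$ admitting such a coloring. A partial coloring on $U\subseteq V(G)$ has partial induced edge coloring on $G[U]$. EDGe on $G$: two players, Player 1 first, alternately color an uncolored vertex with a color from $[\lambda(G)]$; a move is legal iff afterwards the partial induced edge coloring of the colored vertices is injective. The player making the last legal move wins. A winning strategy guarantees a win regardless of the opponent's play. -}

module Defs where

open import Data.Nat using (ℕ; zero; suc; _<_)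
open import Data.Nat.DivMod using (_%_; m%n<n)
open import Data.Fin using (Fin; toℕ; fromℕ<; _≟_)
open import Data.Maybe using (Maybe; just; nothing)
open import Data.Product using (Σ; ∃; _×_; _,_)
open import Data.Sum using (_⊎_)
open import Data.Bool using (if_then_else_)
open import Relation.Nullary using (¬_; does)
open import Relation.Binary.PropositionalEquality using (_≡_)

-- The cycle C_(suc m) on vertices Fin (suc m) (vertex i adjacent to i+1 mod (suc m)).
-- Its edges are indexed by Fin (suc m): edge e = {e , next e}.
-- (For n ≥ 3 this indexing is a bijection onto the edge set.)
next : ∀ {m} → Fin (suc m) → Fin (suc m)
next {m} i = fromℕ< (m%n<n (suc (toℕ i)) (suc m))

SameMultiset : ∀ {k} → Fin k → Fin k → Fin k → Fin k → Set
SameMultiset a b a' b' = (a ≡ a' × b ≡ b') ⊎ (a ≡ b' × b ≡ a')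

EdgeDistinguishing : ∀ {m k} → (Fin (suc m) → Fin k) → Set
EdgeDistinguishing {m} c =
  ∀ (e e' : Fin (suc m)) →
    SameMultiset (c e) (c (next e)) (c e') (c (next e')) → e ≡ e'

IsLambda : ℕ → ℕ → Set
IsLambda m k =
  (Σ (Fin (suc m) → Fin k) EdgeDistinguishing) ×
  (∀ j → j < k → ¬ Σ (Fin (suc m) → Fin j) EdgeDistinguishing)

Partial : ℕ → ℕ → Set
Partial m k = Fin (suc m) → Maybe (Fin k)

ValidPartial : ∀ {m k} → Partial m k → Set
ValidPartial {m} {k} p =
  ∀ (e e' : Fin (suc m)) (a b a' b' : Fin k) →
    p e ≡ just a → p (next e) ≡ just b →
    p e' ≡ just a' → p (next e') ≡ just b' →
    SameMultiset a b a' b' → e ≡ e'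

set : ∀ {m k} → Partial m k → Fin (suc m) → Fin k → Partial m k
set p v c w = if does (w ≟ v) then just c else p w

-- Game positions: Win p = the player to move at p has a winning strategy;
-- Lose p = every legal move of the player to move leads to a position won by the opponent
-- (in particular, if there is no legal move, the player to move loses: last legal move wins).
mutual
  data Win {m k : ℕ} (p : Partial m k) : Set where
    win : (v : Fin (suc m)) (c : Fin k) → p v ≡ nothing →
          ValidPartial (set p v c) → Lose (set p v c) → Win p

  data Lose {m k : ℕ} (p : Partial m k) : Set where
    lose : (∀ (v : Fin (suc m)) (c : Fin k) → p v ≡ nothing →
             ValidPartial (set p v c) → Win (set p v c)) → Lose p

empty : ∀ {m k} → Partial m k
empty _ = nothing

{-# OPTIONS --safe #-}
-- λ(C₆) = 3: the colouring 0 0 1 1 2 2 distinguishes the edges, and an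
-- exhaustive check shows that no colouring with fewer colours does. As λ is
-- unique, it remains to solve the game with three colours. It lasts at most
-- six moves (one per vertex), so a depth-six search of the finite game tree
-- yields an explicit winning strategy for the first player.
module Submission where

open import Defs
open import Data.Nat using (ℕ; zero; suc; _<_; s≤s)
open import Data.Nat.Properties using (<-cmp)
open import Data.Fin using (Fin; zero; suc; _≟_; #_)
open import Data.Fin.Properties using (all?)
open import Data.Vec.Functional using (_∷_; []; head; tail; foldr)
open import Data.Maybe using (Maybe; just; nothing; from-just; _<∣>_)
import Data.Maybe as Maybe
open import Data.Product using (Σ; _,_)
open import Data.Empty using (⊥-elim)
open import Function using (_∘_)
open import Relation.Nullary using (¬_; Dec; yes; no)
open import Relation.Nullary.Decidable using (_×-dec_; _⊎-dec_; _→-dec_; ¬?; map′; from-yes)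
open import Relation.Binary.Definitions using (tri<; tri≈; tri>)
open import Relation.Binary.PropositionalEquality using (_≡_; refl; sym; _≗_)

private
  variable
    m k : ℕ

sameMultiset? : (a b a' b' : Fin k) → Dec (SameMultiset a b a' b')
sameMultiset? a b a' b' = ((a ≟ a') ×-dec (b ≟ b')) ⊎-dec ((a ≟ b') ×-dec (b ≟ a'))

SameMultiset-resp : {a b a' b' x y x' y' : Fin k} →
  a ≡ x → b ≡ y → a' ≡ x' → b' ≡ y' →
  SameMultiset x y x' y' → SameMultiset a b a' b'
SameMultiset-resp refl refl refl refl same = same

edgeDistinguishing? : (c : Fin (suc m) → Fin k) → Dec (EdgeDistinguishing c)
edgeDistinguishing? c = all? λ e → all? λ e' →
  sameMultiset? (c e) (c (next e)) (c e') (c (next e')) →-dec (e ≟ e')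

EdgeDistinguishing-resp : {c d : Fin (suc m) → Fin k} →
  c ≗ d → EdgeDistinguishing c → EdgeDistinguishing d
EdgeDistinguishing-resp c≗d distinguishing e e' same =
  distinguishing e e' (SameMultiset-resp (c≗d e) (c≗d (next e)) (c≗d e') (c≗d (next e')) same)

validPartial? : (p : Partial m k) → Dec (ValidPartial p)
validPartial? p = all? λ e → all? λ e' → edgePair? e e'
  where
  edgePair? : ∀ e e' → Dec (∀ (a b a' b' : Fin _) →
    p e ≡ just a → p (next e) ≡ just b → p e' ≡ just a' → p (next e') ≡ just b' →
    SameMultiset a b a' b' → e ≡ e')
  edgePair? e e' with p e | p (next e) | p e' | p (next e')
  ... | nothing | _       | _       | _       = yes λ { _ _ _ _ () }
  ... | just _  | nothing | _       | _       = yes λ { _ _ _ _ _ () }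
  ... | just _  | just _  | nothing | _       = yes λ { _ _ _ _ _ _ () }
  ... | just _  | just _  | just _  | nothing = yes λ { _ _ _ _ _ _ _ () }
  ... | just a  | just b  | just a' | just b' with e ≟ e' | sameMultiset? a b a' b'
  ...   | yes e≡e' | _         = yes λ _ _ _ _ _ _ _ _ _ → e≡e'
  ...   | no e≢e'  | yes same  = no λ h → e≢e' (h a b a' b' refl refl refl refl same)
  ...   | no _     | no ¬same  = yes λ { _ _ _ _ refl refl refl refl same → ⊥-elim (¬same same) }

∀-function? : {n : ℕ} {P : (Fin n → Fin k) → Set} →
  (∀ {f g} → f ≗ g → P f → P g) → (∀ f → Dec (P f)) → Dec (∀ f → P f)
∀-function? {n = zero} resp P? with P? []
... | yes p[] = yes λ f → resp (λ ()) p[]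
... | no ¬p[] = no λ all → ¬p[] (all [])
∀-function? {n = suc n} resp P? =
  map′ (λ all f → resp head∷tail (all (head f) (tail f))) (λ all x g → all (x ∷ g))
       (all? λ x → ∀-function? (resp ∘ ∷-cong x) (P? ∘ (x ∷_)))
  where
  head∷tail : ∀ {f : Fin (suc n) → Fin _} → (head f ∷ tail f) ≗ f
  head∷tail zero    = refl
  head∷tail (suc i) = refl

  ∷-cong : ∀ x {g h : Fin n → Fin _} → g ≗ h → (x ∷ g) ≗ (x ∷ h)
  ∷-cong x g≗h zero    = refl
  ∷-cong x g≗h (suc i) = g≗h i

IsLambda-unique : {k k' : ℕ} → IsLambda m k → IsLambda m k' → k ≡ k'
IsLambda-unique {k = k} {k'} (colouring , minimal) (colouring' , minimal') with <-cmp k k'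
... | tri< k<k' _ _ = ⊥-elim (minimal' k k<k' colouring)
... | tri≈ _ k≡k' _ = k≡k'
... | tri> _ _ k>k' = ⊥-elim (minimal k' k>k' colouring')

noColouring? : ∀ m j → Dec (∀ (c : Fin (suc m) → Fin j) → ¬ EdgeDistinguishing c)
noColouring? m j =
  ∀-function? (λ c≗d ¬c → ¬c ∘ EdgeDistinguishing-resp (sym ∘ c≗d)) (¬? ∘ edgeDistinguishing?)

C₆-lambda : IsLambda 5 3
C₆-lambda = (colouring , from-yes (edgeDistinguishing? colouring)) , fewerColours
  where
  colouring : Fin 6 → Fin 3
  colouring = # 0 ∷ # 0 ∷ # 1 ∷ # 1 ∷ # 2 ∷ # 2 ∷ []

  fewerColours : ∀ j → j < 3 → ¬ Σ (Fin 6 → Fin j) EdgeDistinguishing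
  fewerColours 0 _ (c , distinguishing) = from-yes (noColouring? 5 0) c distinguishing
  fewerColours 1 _ (c , distinguishing) = from-yes (noColouring? 5 1) c distinguishing
  fewerColours 2 _ (c , distinguishing) = from-yes (noColouring? 5 2) c distinguishing
  fewerColours (suc (suc (suc _))) (s≤s (s≤s (s≤s ())))

allJust : {n : ℕ} {P : Fin n → Set} → (∀ i → Maybe (P i)) → Maybe (∀ i → P i)
allJust {n = zero}  f = just λ ()
allJust {n = suc n} f with f zero | allJust (f ∘ suc)
... | just p₀ | just pₛ = just λ { zero → p₀ ; (suc i) → pₛ i }
... | _       | _       = nothing

firstJust : {n : ℕ} {A : Set} → (Fin n → Maybe A) → Maybe A
firstJust = foldr _<∣>_ nothing

-- Sound but incomplete: `nothing` only means that no certificate was found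
-- within the given bound on the number of remaining moves.
mutual
  findWin : ℕ → (p : Partial m k) → Maybe (Win p)
  findWin zero    p = nothing
  findWin (suc n) p = firstJust λ v → firstJust λ c → winningMove n p v c

  winningMove : ℕ → (p : Partial m k) (v : Fin (suc m)) (c : Fin k) → Maybe (Win p)
  winningMove n p v c with p v in uncoloured | validPartial? (set p v c)
  ... | nothing | yes valid = Maybe.map (win v c uncoloured valid) (findLose n (set p v c))
  ... | _       | _         = nothing

  findLose : ℕ → (p : Partial m k) → Maybe (Lose p)
  findLose n p = Maybe.map lose (allJust λ v → allJust λ c → reply n p v c)

  reply : ℕ → (p : Partial m k) (v : Fin (suc m)) (c : Fin k) →
    Maybe (p v ≡ nothing → ValidPartial (set p v c) → Win (set p v c))
  reply n p v c with p v | validPartial? (set p v c)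
  ... | just _  | _         = just λ ()
  ... | nothing | no invalid = just λ _ valid → ⊥-elim (invalid valid)
  ... | nothing | yes _      = Maybe.map (λ w _ _ → w) (findWin n (set p v c))

C₆-first-player-wins : Win {5} {3} empty
C₆-first-player-wins = from-just (findWin {5} {3} 6 empty)

theorem3p15 : (k : ℕ) → IsLambda 5 k → Win {5} {k} empty
theorem3p15 k isLambda with IsLambda-unique isLambda C₆-lambda
... | refl = C₆-first-player-wins
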